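{- For every prime $p\geq 7$, $\tau_p\leq p-1$; that is, there exists a covering system of the integers in which $p$ is used exactly $p-1$ times as a modulus and all other moduli are odd, pairwise distinct, square-free, and greater than $1$.
   Context: A covering system of the integers is a finite collection of congruences $x\equiv r_j\pmod{m_j}$ such that every integer satisfies at least one of them. For an odd prime $p$, $\tau_p$ denotes the smallest nonnegative integer $\tau$ for which there exists a covering system of the integers that has $p$ as a modulus exactly $\tau$ times, such that all other moduli are odd, distinct, square-free, and greater than $1$. -}

module Defs where

open import Data.Nat using (ℕ; _<_; _≟_; _*_)
open import Data.Nat.Divisibility as ℕD using ()
open import Data.Integer using (ℤ; +_; _-_)
open import Data.Integer.Divisibility using (_∣_)
open import Data.Product using (_×_; _,_; proj₂)
open import Data.List using (List; length; filter; map)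
open import Data.List.Relation.Unary.Any using (Any)
open import Data.List.Relation.Unary.All using (All)
open import Data.List.Relation.Unary.Unique.Propositional using (Unique)
open import Relation.Binary.PropositionalEquality using (_≡_)
open import Relation.Nullary using (¬_)
open import Relation.Nullary.Decidable using (¬?)

-- A congruence  x ≡ r (mod m)  is recorded as the pair (r , m).
Congruence : Set
Congruence = ℤ × ℕ

Satisfies : ℤ → Congruence → Set
Satisfies x (r , m) = (+ m) ∣ (x - r)

-- A finite collection (list, so repetitions allowed) of congruences is a
-- covering system if every integer satisfies at least one of them.
IsCovering : List Congruence → Set
IsCovering S = ∀ (x : ℤ) → Any (Satisfies x) S

SquareFree : ℕ → Set
SquareFree n = ∀ (d : ℕ) → (d * d) ℕD.∣ n → d ≡ 1

Odd : ℕ → Set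
Odd n = ¬ (2 ℕD.∣ n)

moduli : List Congruence → List ℕ
moduli S = map proj₂ S

otherModuli : ℕ → List Congruence → List ℕ
otherModuli p S = filter (λ m → ¬? (m ≟ p)) (moduli S)

AdmissibleCovering : ℕ → ℕ → List Congruence → Set
AdmissibleCovering p τ S =
  IsCovering S
  × length (filter (λ m → m ≟ p) (moduli S)) ≡ τ
  × All (λ m → Odd m × SquareFree m × 1 < m) (otherModuli p S)
  × Unique (otherModuli p S)

module Submission where

-- The classes 1, …, p − 1 mod p leave only the multiples x = p y uncovered.  Take a covering of ℤ by
-- classes whose moduli are odd, square-free, coprime to p and greater than 1, in which every modulus
-- is used at most twice (a first and a second family, each with distinct moduli).  A class r mod m
-- containing y gives the class p r mod m (first family) or p r mod p m (second family) containing
-- x = p y; the new moduli m and p m are pairwise distinct, odd and square-free, and none equals p.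
-- Such coverings exist with moduli the divisors > 1 of 105 (for p > 7) and of 3·5·11·13·17·19
-- (for p = 7); they are verified by testing every residue below the common multiple.

open import Defs
open import Data.Nat using (ℕ; _≤_; _∸_)
open import Data.Nat.Primality using (Prime)
open import Data.Product using (∃)

open import Data.Bool using (Bool; true; false; T; _∧_; _∨_)
open import Data.Bool.Properties using (T-≡; T-∧; T-∨)
open import Data.Integer as ℤ using (+_)
import Data.Integer.Properties as ℤ
open import Data.Integer.Divisibility.Signed as ℤ using (divides; ∣ᵤ⇒∣; ∣⇒∣ᵤ)
open import Data.Integer.DivMod using (a≡a%ℕn+[a/ℕn]*n; n%ℕd<d)
open import Data.Integer.Tactic.RingSolver using (solve-∀)
open import Data.List using (List; []; _∷_; _++_; map; filter; length; replicate)
import Data.List.Properties as List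
open import Data.List.Membership.Propositional using (_∈_; lose)
open import Data.List.Membership.Propositional.Properties using (∈-map⁻)
open import Data.List.Relation.Unary.All using (All; []; _∷_)
import Data.List.Relation.Unary.All as All
import Data.List.Relation.Unary.All.Properties as All
open import Data.List.Relation.Unary.AllPairs using ([]; _∷_)
open import Data.List.Relation.Unary.Any using (Any; here; there)
import Data.List.Relation.Unary.Any as Any
import Data.List.Relation.Unary.Any.Properties as Any
open import Data.List.Relation.Unary.Unique.Propositional using (Unique)
import Data.List.Relation.Unary.Unique.Propositional.Properties as Unique
open import Data.Nat as ℕ using (zero; suc; _*_; _<_; _%_; _/_; _≡ᵇ_; z≤n; s≤s; NonZero)
open import Data.List.Relation.Unary.Unique.DecPropositional ℕ._≟_ using (unique?)
open import Data.Nat.Coprimality using (Coprime; coprime-divisor)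
import Data.Nat.Coprimality as Coprime
open import Data.Nat.Divisibility as ℕ using (_∣?_; ∣-trans; *-pres-∣; ∣1⇒≡1; *-cancelˡ-∣)
open import Data.Nat.DivMod using (m≡m%n+[m/n]*n)
open import Data.Nat.ListAction using (product)
open import Data.Nat.Primality using (prime?; prime[2]; ¬prime[1]; euclidsLemma; prime⇒irreducible; prime⇒nonZero; productOfPrimes≢0)
import Data.Nat.Properties as ℕ
open import Data.Product using (_×_; _,_; proj₁; proj₂)
open import Data.Sum as Sum using (inj₁; inj₂; [_,_])
open import Function using (_∘_)
open import Function.Bundles using (Equivalence)
open import Relation.Binary.PropositionalEquality
  using (_≡_; _≢_; refl; sym; trans; cong; cong₂; subst; subst₂; module ≡-Reasoning)
open import Relation.Nullary using (¬_; yes; no; contradiction; _×-dec_)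
open import Relation.Nullary.Decidable using (¬?; from-yes)

AdmissibleModulus : ℕ → Set
AdmissibleModulus m = Odd m × SquareFree m × 1 < m

odd-∣ : ∀ {m n} → m ℕ.∣ n → Odd n → Odd m
odd-∣ m∣n odd-n 2∣m = odd-n (∣-trans 2∣m m∣n)

odd-* : ∀ {m n} → Odd m → Odd n → Odd (m * n)
odd-* odd-m odd-n 2∣mn = [ odd-m , odd-n ] (euclidsLemma _ _ prime[2] 2∣mn)

odd-product : ∀ {ns} → All Odd ns → Odd (product ns)
odd-product []               2∣1 with () ← ∣1⇒≡1 2∣1
odd-product (odd-n ∷ odd-ns) = odd-* odd-n (odd-product odd-ns)

squareFree-∣ : ∀ {m n} → m ℕ.∣ n → SquareFree n → SquareFree m
squareFree-∣ m∣n sf-n d dd∣m = sf-n d (∣-trans dd∣m m∣n)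

squareFree-1 : SquareFree 1
squareFree-1 d dd∣1 = ℕ.m*n≡1⇒m≡1 d d (∣1⇒≡1 dd∣1)

prime∤⇒coprime : ∀ {p n} → Prime p → ¬ p ℕ.∣ n → Coprime p n
prime∤⇒coprime pp p∤n (d∣p , d∣n) with prime⇒irreducible pp d∣p
... | inj₁ d≡1  = d≡1
... | inj₂ refl = contradiction d∣n p∤n

squareFree-* : ∀ {q m} → Prime q → ¬ q ℕ.∣ m → SquareFree m → SquareFree (q * m)
squareFree-* {q} pq q∤m sf-m d dd∣qm with q ∣? d
... | yes q∣d = contradiction (*-cancelˡ-∣ q {{prime⇒nonZero pq}} (∣-trans (*-pres-∣ q∣d q∣d) dd∣qm)) q∤m
... | no  q∤d = sf-m d (coprime-divisor (Coprime.sym (prime∤⇒coprime pq q∤dd)) dd∣qm)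
  where
  q∤dd : ¬ q ℕ.∣ d * d
  q∤dd = [ q∤d , q∤d ] ∘ euclidsLemma d d pq

prime∣prime⇒≡ : ∀ {p q} → Prime p → Prime q → p ℕ.∣ q → p ≡ q
prime∣prime⇒≡ pp pq p∣q with prime⇒irreducible pq p∣q
... | inj₁ refl = contradiction pp ¬prime[1]
... | inj₂ p≡q  = p≡q

prime∣product⇒∣-some : ∀ {p ns} → Prime p → p ℕ.∣ product ns → Any (p ℕ.∣_) ns
prime∣product⇒∣-some {ns = []}     pp p∣1    = contradiction (subst Prime (∣1⇒≡1 p∣1) pp) ¬prime[1]
prime∣product⇒∣-some {ns = n ∷ ns} pp p∣n*ns =
  Sum.[ here , there ∘ prime∣product⇒∣-some pp ]′ (euclidsLemma n (product ns) pp p∣n*ns)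

squareFree-product : ∀ {qs} → All Prime qs → Unique qs → SquareFree (product qs)
squareFree-product []                      []            = squareFree-1
squareFree-product {q ∷ qs} (pq ∷ pqs) (q∉qs ∷ uniq) = squareFree-* pq q∤qs (squareFree-product pqs uniq)
  where
  q∤qs : ¬ q ℕ.∣ product qs
  q∤qs q∣qs = All.lookupWith (λ (q≢r , pr) q∣r → q≢r (prime∣prime⇒≡ pq pr q∣r))
                             (All.zip (q∉qs , pqs)) (prime∣product⇒∣-some pq q∣qs)

odd-prime : ∀ {p} → Prime p → p ≢ 2 → Odd p
odd-prime pp p≢2 2∣p = p≢2 (sym (prime∣prime⇒≡ prime[2] pp 2∣p))

admissible-* : ∀ {p m} → Prime p → Odd p → ¬ p ℕ.∣ m → AdmissibleModulus m → AdmissibleModulus (p * m)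
admissible-* {p} {m} pp odd-p p∤m (odd-m , sf-m , 1<m) =
  odd-* odd-p odd-m , squareFree-* pp p∤m sf-m , ℕ.<-≤-trans 1<m (ℕ.m≤n*m m p {{prime⇒nonZero pp}})

satisfies⇒∣ : ∀ x c → Satisfies x c → + proj₂ c ℤ.∣ x ℤ.- proj₁ c
satisfies⇒∣ x c = ∣ᵤ⇒∣

∣⇒satisfies : ∀ x c → + proj₂ c ℤ.∣ x ℤ.- proj₁ c → Satisfies x c
∣⇒satisfies x c = ∣⇒∣ᵤ

[i+j]-i≡j : ∀ i j → i ℤ.+ j ℤ.- i ≡ j
[i+j]-i≡j = solve-∀

satisfies-remainder : ∀ x p .{{_ : NonZero p}} → Satisfies x (+ (x ℤ.%ℕ p) , p)
satisfies-remainder x p = ∣⇒satisfies x (+ (x ℤ.%ℕ p) , p) (divides (x ℤ./ℕ p) (begin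
  x ℤ.- + (x ℤ.%ℕ p)                                   ≡⟨ cong (ℤ._- + (x ℤ.%ℕ p)) (a≡a%ℕn+[a/ℕn]*n x p) ⟩
  + (x ℤ.%ℕ p) ℤ.+ (x ℤ./ℕ p) ℤ.* + p ℤ.- + (x ℤ.%ℕ p) ≡⟨ [i+j]-i≡j (+ (x ℤ.%ℕ p)) _ ⟩
  (x ℤ./ℕ p) ℤ.* + p                                   ∎))
  where open ≡-Reasoning

satisfies-+-multiple : ∀ {x L} c → proj₂ c ℕ.∣ L → ∀ q → Satisfies x c → Satisfies (x ℤ.+ q ℤ.* + L) c
satisfies-+-multiple {x} {L} (r , m) m∣L q x∈c =
  ∣⇒satisfies (x ℤ.+ q ℤ.* + L) (r , m)
    (subst (+ m ℤ.∣_) (shift x r (q ℤ.* + L))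
      (ℤ.∣m∣n⇒∣m+n (satisfies⇒∣ x (r , m) x∈c) (ℤ.∣n⇒∣m*n q (∣ᵤ⇒∣ {+ m} {+ L} m∣L))))
  where
  shift : ∀ x r y → x ℤ.- r ℤ.+ y ≡ x ℤ.+ y ℤ.- r
  shift = solve-∀

nonzeroClasses : ℕ → ℕ → List Congruence
nonzeroClasses p zero    = []
nonzeroClasses p (suc k) = (+ suc k , p) ∷ nonzeroClasses p k

∈-nonzeroClasses : ∀ {p r k} → 0 < r → r ≤ k → (+ r , p) ∈ nonzeroClasses p k
∈-nonzeroClasses {r = suc r} {suc k} 0<r r≤k with r ℕ.≟ k
... | yes refl = here refl
... | no  r≢k  = there (∈-nonzeroClasses 0<r (ℕ.≤-pred (ℕ.≤∧≢⇒< r≤k (r≢k ∘ ℕ.suc-injective))))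

moduli-nonzeroClasses : ∀ p k → moduli (nonzeroClasses p k) ≡ replicate k p
moduli-nonzeroClasses p zero    = refl
moduli-nonzeroClasses p (suc k) = cong (p ∷_) (moduli-nonzeroClasses p k)

dilate : ℕ → Congruence → Congruence
dilate p (r , m) = (+ p ℤ.* r , p * m)

dilateResidue : ℕ → Congruence → Congruence
dilateResidue p (r , m) = (+ p ℤ.* r , m)

dilate-sub : ∀ y r p → (y ℤ.- r) ℤ.* p ≡ y ℤ.* p ℤ.- p ℤ.* r
dilate-sub = solve-∀

satisfies-dilateResidue : ∀ {y} p c → Satisfies y c → Satisfies (y ℤ.* + p) (dilateResidue p c)
satisfies-dilateResidue {y} p (r , m) y∈c =
  ∣⇒satisfies (y ℤ.* + p) (dilateResidue p (r , m))
    (subst (+ m ℤ.∣_) (dilate-sub y r (+ p)) (ℤ.∣m⇒∣m*n (+ p) (satisfies⇒∣ y (r , m) y∈c)))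

satisfies-dilate : ∀ {y} p c → Satisfies y c → Satisfies (y ℤ.* + p) (dilate p c)
satisfies-dilate {y} p (r , m) y∈c =
  ∣⇒satisfies (y ℤ.* + p) (dilate p (r , m))
    (subst₂ ℤ._∣_ mp≡pm (dilate-sub y r (+ p)) (ℤ.*-monoˡ-∣ (+ p) (satisfies⇒∣ y (r , m) y∈c)))
  where
  mp≡pm : + m ℤ.* + p ≡ + (p * m)
  mp≡pm = trans (sym (ℤ.pos-* m p)) (cong +_ (ℕ.*-comm m p))

-- Lifting a covering to one using p exactly p − 1 times

liftedCovering : ℕ → List Congruence → List Congruence → List Congruence
liftedCovering p A B = nonzeroClasses p (p ∸ 1) ++ map (dilateResidue p) A ++ map (dilate p) B

dilations-cover : ∀ p A B → IsCovering (A ++ B) → ∀ y →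
                  Any (Satisfies (y ℤ.* + p)) (map (dilateResidue p) A ++ map (dilate p) B)
dilations-cover p A B cover y =
  Sum.[ Any.++⁺ˡ ∘ Any.map⁺ ∘ Any.map (satisfies-dilateResidue {y} p _)
      , Any.++⁺ʳ (map (dilateResidue p) A) ∘ Any.map⁺ ∘ Any.map (satisfies-dilate {y} p _)
      ]′ (Any.++⁻ A (cover y))

liftedCovering-covers : ∀ p .{{_ : NonZero p}} A B → IsCovering (A ++ B) → IsCovering (liftedCovering p A B)
liftedCovering-covers p A B cover x with x ℤ.%ℕ p | satisfies-remainder x p | n%ℕd<d x p
... | zero  | x∈0 | _ with divides y x≡yp ← satisfies⇒∣ x (+ 0 , p) x∈0 =
  Any.++⁺ʳ (nonzeroClasses p (p ∸ 1))
    (subst (λ z → Any (Satisfies z) _) (sym (trans (sym (ℤ.+-identityʳ x)) x≡yp)) (dilations-cover p A B cover y))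
... | suc r | x∈r | r<p = Any.++⁺ˡ (lose (∈-nonzeroClasses (s≤s z≤n) (ℕ.∸-monoˡ-≤ 1 r<p)) x∈r)

liftedModuli : ℕ → List Congruence → List Congruence → List ℕ
liftedModuli p A B = moduli A ++ map (p *_) (moduli B)

moduli-liftedCovering : ∀ p A B → moduli (liftedCovering p A B) ≡ replicate (p ∸ 1) p ++ liftedModuli p A B
moduli-liftedCovering p A B = begin
  moduli (liftedCovering p A B)
    ≡⟨ List.map-++ proj₂ (nonzeroClasses p (p ∸ 1)) _ ⟩
  moduli (nonzeroClasses p (p ∸ 1)) ++ moduli (map (dilateResidue p) A ++ map (dilate p) B)
    ≡⟨ cong₂ _++_ (moduli-nonzeroClasses p (p ∸ 1)) (List.map-++ proj₂ (map (dilateResidue p) A) _) ⟩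
  replicate (p ∸ 1) p ++ moduli (map (dilateResidue p) A) ++ moduli (map (dilate p) B)
    ≡⟨ cong (replicate (p ∸ 1) p ++_) (cong₂ _++_ (sym (List.map-∘ A)) (trans (sym (List.map-∘ B)) (List.map-∘ B))) ⟩
  replicate (p ∸ 1) p ++ liftedModuli p A B ∎
  where open ≡-Reasoning

module _ {p : ℕ} {ms : List ℕ} (ms≢p : All (_≢ p) ms) where

  count-replicate-++ : ∀ k → length (filter (λ m → m ℕ.≟ p) (replicate k p ++ ms)) ≡ k
  count-replicate-++ k = begin
    length (filter (λ m → m ℕ.≟ p) (replicate k p ++ ms))
      ≡⟨ cong length (List.filter-++ (λ m → m ℕ.≟ p) (replicate k p) ms) ⟩
    length (filter (λ m → m ℕ.≟ p) (replicate k p) ++ filter (λ m → m ℕ.≟ p) ms)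
      ≡⟨ cong₂ (λ xs ys → length (xs ++ ys)) (List.filter-all (λ m → m ℕ.≟ p) (All.replicate⁺ k refl))
                                              (List.filter-none (λ m → m ℕ.≟ p) ms≢p) ⟩
    length (replicate k p ++ [])
      ≡⟨ cong length (List.++-identityʳ (replicate k p)) ⟩
    length (replicate k p)
      ≡⟨ List.length-replicate k ⟩
    k ∎
    where open ≡-Reasoning

  others-replicate-++ : ∀ k → filter (λ m → ¬? (m ℕ.≟ p)) (replicate k p ++ ms) ≡ ms
  others-replicate-++ zero    = List.filter-all (λ m → ¬? (m ℕ.≟ p)) ms≢p
  others-replicate-++ (suc k) =
    trans (List.filter-reject (λ m → ¬? (m ℕ.≟ p)) (λ p≢p → p≢p refl)) (others-replicate-++ k)

record TwofoldCovering (p : ℕ) : Set where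
  field
    classes₁ classes₂ : List Congruence
    covers            : IsCovering (classes₁ ++ classes₂)
    admissible        : All AdmissibleModulus (moduli (classes₁ ++ classes₂))
    coprime           : All (λ m → ¬ p ℕ.∣ m) (moduli (classes₁ ++ classes₂))
    distinct₁         : Unique (moduli classes₁)
    distinct₂         : Unique (moduli classes₂)

All-moduli-++⁻ : ∀ {P : ℕ → Set} A B → All P (moduli (A ++ B)) → All P (moduli A) × All P (moduli B)
All-moduli-++⁻ {P} A B = All.++⁻ (moduli A) ∘ subst (All P) (List.map-++ proj₂ A B)

module Lift {p : ℕ} (pp : Prime p) (odd-p : Odd p) (T : TwofoldCovering p) where
  open TwofoldCovering T
  instance _ = prime⇒nonZero pp

  lift : List Congruence
  lift = liftedCovering p classes₁ classes₂

  others : List ℕ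
  others = liftedModuli p classes₁ classes₂

  admissible₁ : All AdmissibleModulus (moduli classes₁)
  admissible₁ = proj₁ (All-moduli-++⁻ classes₁ classes₂ admissible)

  admissible₂ : All AdmissibleModulus (moduli classes₂)
  admissible₂ = proj₂ (All-moduli-++⁻ classes₁ classes₂ admissible)

  coprime₁ : All (λ m → ¬ p ℕ.∣ m) (moduli classes₁)
  coprime₁ = proj₁ (All-moduli-++⁻ classes₁ classes₂ coprime)

  coprime₂ : All (λ m → ¬ p ℕ.∣ m) (moduli classes₂)
  coprime₂ = proj₂ (All-moduli-++⁻ classes₁ classes₂ coprime)

  others-admissible : All AdmissibleModulus others
  others-admissible = All.++⁺ admissible₁
    (All.map⁺ (All.zipWith (λ (p∤m , adm) → admissible-* pp odd-p p∤m adm) (coprime₂ , admissible₂)))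

  others≢p : All (_≢ p) others
  others≢p = All.++⁺ (All.map (λ p∤m m≡p → p∤m (ℕ.∣-reflexive (sym m≡p))) coprime₁)
                     (All.map⁺ (All.map (λ (_ , _ , 1<m) pm≡p → ℕ.<⇒≢ (ℕ.m<m*n p _ 1<m) (sym pm≡p)) admissible₂))

  others-distinct : Unique others
  others-distinct = Unique.++⁺ distinct₁ (Unique.map⁺ (ℕ.*-cancelˡ-≡ _ _ p) distinct₂) disjoint
    where
    disjoint : ∀ {m} → ¬ (m ∈ moduli classes₁ × m ∈ map (p *_) (moduli classes₂))
    disjoint (m∈₁ , m∈₂) with ∈-map⁻ (p *_) m∈₂
    ... | n , _ , refl = All.lookup coprime₁ m∈₁ (ℕ.m∣m*n n)

  otherModuli-lift : otherModuli p lift ≡ others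
  otherModuli-lift = trans (cong (filter (λ m → ¬? (m ℕ.≟ p))) (moduli-liftedCovering p classes₁ classes₂))
                           (others-replicate-++ others≢p (p ∸ 1))

  count-lift : length (filter (λ m → m ℕ.≟ p) (moduli lift)) ≡ p ∸ 1
  count-lift = trans (cong (length ∘ filter (λ m → m ℕ.≟ p)) (moduli-liftedCovering p classes₁ classes₂))
                     (count-replicate-++ others≢p (p ∸ 1))

  lift-admissible : AdmissibleCovering p (p ∸ 1) lift
  lift-admissible =
    liftedCovering-covers p classes₁ classes₂ covers ,
    count-lift ,
    subst (All AdmissibleModulus) (sym otherModuli-lift) others-admissible ,
    subst Unique (sym otherModuli-lift) others-distinct

-- Verifying a covering by its residues modulo a common multiple of the moduli

hits : ℕ → Congruence → Bool
hits n (+ s , suc k) = n % suc k ≡ᵇ s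
hits n _             = false

hitsSome : ℕ → List Congruence → Bool
hitsSome n []       = false
hitsSome n (c ∷ cs) = hits n c ∨ hitsSome n cs

coversBelow : ℕ → List Congruence → Bool
coversBelow zero    cs = true
coversBelow (suc n) cs = hitsSome n cs ∧ coversBelow n cs

hits-sound : ∀ n c → T (hits n c) → Satisfies (+ n) c
hits-sound n (+ s , suc k) hit = ∣⇒satisfies (+ n) (+ s , suc k) (divides (+ (n / suc k)) (begin
  + n ℤ.- + s                                 ≡⟨ cong (λ i → + i ℤ.- + s) (m≡m%n+[m/n]*n n (suc k)) ⟩
  + (n % suc k ℕ.+ n / suc k * suc k) ℤ.- + s ≡⟨ cong (λ r → + (r ℕ.+ n / suc k * suc k) ℤ.- + s) n%m≡s ⟩
  + (s ℕ.+ n / suc k * suc k) ℤ.- + s         ≡⟨ cong (ℤ._- + s) (ℤ.pos-+ s _) ⟩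
  + s ℤ.+ + (n / suc k * suc k) ℤ.- + s       ≡⟨ [i+j]-i≡j (+ s) _ ⟩
  + (n / suc k * suc k)                       ≡⟨ ℤ.pos-* (n / suc k) (suc k) ⟩
  + (n / suc k) ℤ.* + suc k                   ∎))
  where
  open ≡-Reasoning
  n%m≡s : n % suc k ≡ s
  n%m≡s = ℕ.≡ᵇ⇒≡ (n % suc k) s hit

coversBelow-sound : ∀ {n} L cs → n < L → T (coversBelow L cs) → T (hitsSome n cs)
coversBelow-sound {n} (suc L) cs n<L covered with Equivalence.to T-∧ covered | n ℕ.≟ L
... | hit , _        | yes refl = hit
... | _   , covered′ | no  n≢L  = coversBelow-sound L cs (ℕ.≤∧≢⇒< (ℕ.≤-pred n<L) n≢L) covered′

hitsSome-covers : ∀ {L} n q cs → All (λ c → proj₂ c ℕ.∣ L) cs → T (hitsSome n cs) →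
                  Any (Satisfies (+ n ℤ.+ q ℤ.* + L)) cs
hitsSome-covers n q (c ∷ cs) (m∣L ∷ m∣Ls) hit with Equivalence.to T-∨ hit
... | inj₁ hit-c  = here (satisfies-+-multiple {+ n} c m∣L q (hits-sound n c hit-c))
... | inj₂ hit-cs = there (hitsSome-covers n q cs m∣Ls hit-cs)

-- Stated with _≡ true so that callers discharge it by refl: the conversion checker evaluates
-- the test far faster than it solves a goal T (coversBelow L cs) by eta.
coversBelow⇒covering : ∀ L .{{_ : NonZero L}} cs → All (λ c → proj₂ c ℕ.∣ L) cs →
                       coversBelow L cs ≡ true → IsCovering cs
coversBelow⇒covering L cs m∣L covered x =
  subst (λ y → Any (Satisfies y) cs) (sym (a≡a%ℕn+[a/ℕn]*n x L))
    (hitsSome-covers (x ℤ.%ℕ L) (x ℤ./ℕ L) cs m∣L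
      (coversBelow-sound L cs (n%ℕd<d x L) (Equivalence.from T-≡ covered)))

twofold-fromResidueCheck :
  ∀ {p} qs (A B : List Congruence) → All Prime qs → All Odd qs → Unique qs → ¬ p ℕ.∣ product qs →
  All (λ m → m ℕ.∣ product qs × 1 < m) (moduli (A ++ B)) → Unique (moduli A) → Unique (moduli B) →
  coversBelow (product qs) (A ++ B) ≡ true → TwofoldCovering p
twofold-fromResidueCheck qs A B primes odds distinct p∤L m∣L distinct₁ distinct₂ covered = record
  { classes₁   = A
  ; classes₂   = B
  ; covers     = coversBelow⇒covering (product qs) {{productOfPrimes≢0 primes}} (A ++ B)
                   (All.map⁻ (All.map proj₁ m∣L)) covered
  ; admissible = All.map (λ (m∣L , 1<m) → odd-∣ m∣L (odd-product odds) ,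
                                          squareFree-∣ m∣L (squareFree-product primes distinct) , 1<m) m∣L
  ; coprime    = All.map (λ (m∣L , _) p∣m → p∤L (∣-trans p∣m m∣L)) m∣L
  ; distinct₁  = distinct₁
  ; distinct₂  = distinct₂
  }

classes₁-105 : List Congruence
classes₁-105 =
    (+ 1 , 3) ∷ (+ 3 , 5) ∷ (+ 9 , 15) ∷ (+ 0 , 7) ∷ (+ 9 , 21) ∷ (+ 25 , 35)
  ∷ (+ 90 , 105)
  ∷ []

classes₂-105 : List Congruence
classes₂-105 =
    (+ 2 , 3) ∷ (+ 1 , 5) ∷ (+ 12 , 15) ∷ (+ 1 , 7) ∷ (+ 3 , 21) ∷ (+ 5 , 35)
  ∷ []

classes₁-692835 : List Congruence
classes₁-692835 =
    (+ 1 , 3) ∷ (+ 3 , 5) ∷ (+ 9 , 15) ∷ (+ 3 , 11) ∷ (+ 30 , 33) ∷ (+ 50 , 55)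
  ∷ (+ 45 , 165) ∷ (+ 3 , 13) ∷ (+ 15 , 39) ∷ (+ 50 , 65) ∷ (+ 60 , 195) ∷ (+ 7 , 17)
  ∷ (+ 6 , 51) ∷ (+ 30 , 85) ∷ (+ 120 , 255) ∷ (+ 9 , 19) ∷ (+ 24 , 57) ∷ (+ 30 , 95)
  ∷ (+ 90 , 285) ∷ (+ 70 , 143) ∷ (+ 357 , 429) ∷ (+ 170 , 715) ∷ (+ 720 , 2145) ∷ (+ 54 , 187)
  ∷ (+ 450 , 561) ∷ (+ 10 , 935) ∷ (+ 2265 , 2805) ∷ (+ 156 , 209) ∷ (+ 546 , 627) ∷ (+ 230 , 1045)
  ∷ (+ 3000 , 3135) ∷ (+ 62 , 221) ∷ (+ 192 , 663) ∷ (+ 270 , 1105) ∷ (+ 1635 , 3315) ∷ (+ 49 , 247)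
  ∷ (+ 327 , 741) ∷ (+ 1040 , 1235) ∷ (+ 480 , 3705) ∷ (+ 6 , 323) ∷ (+ 153 , 969) ∷ (+ 1355 , 1615)
  ∷ (+ 645 , 4845) ∷ (+ 621 , 2431) ∷ (+ 2463 , 7293) ∷ (+ 400 , 12155) ∷ (+ 12000 , 36465) ∷ (+ 672 , 2717)
  ∷ (+ 300 , 8151) ∷ (+ 10615 , 13585) ∷ (+ 25095 , 40755) ∷ (+ 1409 , 3553) ∷ (+ 3393 , 10659) ∷ (+ 15935 , 17765)
  ∷ (+ 13665 , 53295) ∷ (+ 1024 , 4199) ∷ (+ 192 , 12597) ∷ (+ 17045 , 20995) ∷ (+ 2250 , 62985) ∷ (+ 19709 , 46189)
  ∷ (+ 23439 , 138567) ∷ (+ 86465 , 230945) ∷ (+ 301650 , 692835)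
  ∷ []

classes₂-692835 : List Congruence
classes₂-692835 =
    (+ 2 , 3) ∷ (+ 1 , 5) ∷ (+ 12 , 15) ∷ (+ 0 , 11) ∷ (+ 24 , 33) ∷ (+ 40 , 55)
  ∷ (+ 75 , 165) ∷ (+ 12 , 13) ∷ (+ 30 , 39) ∷ (+ 20 , 65) ∷ (+ 165 , 195) ∷ (+ 0 , 17)
  ∷ (+ 48 , 51) ∷ (+ 70 , 85) ∷ (+ 135 , 255) ∷ (+ 11 , 19) ∷ (+ 3 , 57) ∷ (+ 20 , 95)
  ∷ (+ 165 , 285) ∷ (+ 136 , 143) ∷ (+ 390 , 429) ∷ (+ 235 , 715) ∷ (+ 1170 , 2145) ∷ (+ 175 , 187)
  ∷ (+ 417 , 561) ∷ (+ 725 , 935) ∷ (+ 1440 , 2805) ∷ (+ 144 , 209) ∷ (+ 219 , 627) ∷ (+ 925 , 1045)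
  ∷ (+ 2070 , 3135) ∷ (+ 127 , 221) ∷ (+ 582 , 663) ∷ (+ 335 , 1105) ∷ (+ 2220 , 3315) ∷ (+ 185 , 247)
  ∷ (+ 213 , 741) ∷ (+ 270 , 1235) ∷ (+ 2265 , 3705) ∷ (+ 38 , 323) ∷ (+ 786 , 969) ∷ (+ 0 , 1615)
  ∷ (+ 4185 , 4845) ∷ (+ 153 , 2431) ∷ (+ 780 , 7293) ∷ (+ 8260 , 12155) ∷ (+ 29295 , 36465) ∷ (+ 650 , 2717)
  ∷ (+ 7458 , 8151) ∷ (+ 8480 , 13585) ∷ (+ 25740 , 40755) ∷ (+ 2301 , 3553) ∷ (+ 1128 , 10659) ∷ (+ 15545 , 17765)
  ∷ (+ 22845 , 53295) ∷ (+ 1700 , 4199) ∷ (+ 5232 , 12597) ∷ (+ 4800 , 20995) ∷ (+ 30120 , 62985) ∷ (+ 23534 , 46189)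
  ∷ (+ 96264 , 138567) ∷ (+ 106345 , 230945) ∷ (+ 33075 , 692835)
  ∷ []

twofold-692835 : TwofoldCovering 7
twofold-692835 = twofold-fromResidueCheck primes classes₁-692835 classes₂-692835
  (from-yes (All.all? prime? primes))
  (from-yes (All.all? (λ q → ¬? (2 ∣? q)) primes))
  (from-yes (unique? primes))
  (from-yes (¬? (7 ∣? product primes)))
  (from-yes (All.all? (λ m → (m ∣? product primes) ×-dec (1 ℕ.<? m)) (moduli (classes₁-692835 ++ classes₂-692835))))
  (from-yes (unique? (moduli classes₁-692835)))
  (from-yes (unique? (moduli classes₂-692835)))
  refl
  where
  primes : List ℕ
  primes = 3 ∷ 5 ∷ 11 ∷ 13 ∷ 17 ∷ 19 ∷ []

twofold-105 : ∀ {p} → Prime p → 7 < p → TwofoldCovering p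
twofold-105 {p} pp 7<p = twofold-fromResidueCheck primes classes₁-105 classes₂-105
  primes-prime
  (from-yes (All.all? (λ q → ¬? (2 ∣? q)) primes))
  (from-yes (unique? primes))
  p∤105
  (from-yes (All.all? (λ m → (m ∣? product primes) ×-dec (1 ℕ.<? m)) (moduli (classes₁-105 ++ classes₂-105))))
  (from-yes (unique? (moduli classes₁-105)))
  (from-yes (unique? (moduli classes₂-105)))
  refl
  where
  primes : List ℕ
  primes = 3 ∷ 5 ∷ 7 ∷ []
  primes-prime : All Prime primes
  primes-prime = from-yes (All.all? prime? primes)
  p∤105 : ¬ p ℕ.∣ product primes
  p∤105 p∣105 = All.lookupWith (λ (pq , q≤7) p∣q → ℕ.<⇒≱ 7<p (ℕ.≤-trans (ℕ.∣⇒≤ {{prime⇒nonZero pq}} p∣q) q≤7))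
                  (All.zip (primes-prime , from-yes (All.all? (ℕ._≤? 7) primes)))
                  (prime∣product⇒∣-some pp p∣105)

corollary5p2 : ∀ (p : ℕ) → Prime p → 7 ≤ p →
    ∃ λ S → AdmissibleCovering p (p ∸ 1) S
corollary5p2 p pp 7≤p = lift , lift-admissible
  where
  p≢2 : p ≢ 2
  p≢2 p≡2 = ℕ.<⇒≱ (from-yes (2 ℕ.<? 7)) (subst (7 ≤_) p≡2 7≤p)
  twofold : TwofoldCovering p
  twofold with p ℕ.≟ 7
  ... | yes refl = twofold-692835
  ... | no  p≢7  = twofold-105 pp (ℕ.≤∧≢⇒< 7≤p (p≢7 ∘ sym))
  open Lift pp (odd-prime pp p≢2) twofold
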